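{- If $m$ is $k$-near-perfect for some integer $k\ge0$ and $\tau(m)=4$ or $\tau(m)=6$, then $m\in\{6,12,18,20,28\}$.
   Context: $\tau(m)$ is the number of positive divisors of $m$. A natural number $m$ is $k$-near-perfect if $m$ equals the sum of all of its proper divisors except for at most $k$ of them ($0$-near-perfect means perfect). -}

module Defs where

open import Data.Nat using (ℕ; suc; _+_; _≤_; _<_; _<?_)
open import Data.Nat.Divisibility using (_∣?_)
open import Data.List using (List; filter; upTo; length; map)
open import Data.Nat.ListAction using (sum)
open import Data.List.Relation.Binary.Sublist.Propositional using (_⊆_)
open import Data.Product using (Σ; _×_)
open import Relation.Binary.PropositionalEquality using (_≡_)

divisors : ℕ → List ℕ
divisors m = filter (_∣? m) (map suc (upTo m))

τ : ℕ → ℕ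
τ m = length (divisors m)

properDivisors : ℕ → List ℕ
properDivisors m = filter (_<? m) (divisors m)

-- m is k-near-perfect: there is a set S of at most k proper divisors
-- (a sublist of the duplicate-free list of proper divisors) such that
-- m equals the sum of the proper divisors not in S.
NearPerfect : ℕ → ℕ → Set
NearPerfect k m =
  Σ (List ℕ) λ S → (S ⊆ properDivisors m) × (length S ≤ k)
    × (sum (properDivisors m) ≡ m + sum S)

-- Deleting at most k proper divisors of m leaves the sum m, so m ≤ σ(m) − m.
-- The two largest proper divisors d < e satisfy 3d ≤ m and 2e ≤ m (their
-- co-divisors are at least 3 and 2), so the other proper divisors sum to some
-- S with m ≤ 6S.  If τ(m) = 4 then S = 1 and m ≤ 6.  If τ(m) = 6 the proper
-- divisors are 1 < b < c < d < e and S ≤ 2c; moreover c² < m, since otherwise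
-- m/e < m/d would both lie strictly between 1 and c.  Hence c ≤ 11 and
-- m ≤ 132, and the remaining m are checked by evaluation.
module Submission where

open import Defs
open import Data.Nat using (ℕ; zero; suc; _+_; _*_; _≤_; _<_; _≟_; _≤?_; _<?_; z≤n; s≤s; NonZero; >-nonZero)
open import Data.Nat.Properties
open import Data.Nat.Divisibility using (_∣_; _∣?_; quotient; 1∣_; ∣-refl; quotient-∣; quotient>1; quotient≢0; 0∣⇒≡0)
open import Data.Nat.ListAction using (sum)
open import Data.Nat.ListAction.Properties using (sum-++)
open import Data.Nat.Tactic.RingSolver using (solve)
open import Data.List using (List; []; _∷_; [_]; _++_; _∷ʳ_; map; filter; upTo; length)
open import Data.List.Properties using (upTo-∷ʳ; map-++; filter-++; filter-accept; filter-reject; filter-all; length-++; ++-identityʳ)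
open import Data.List.Membership.Propositional using (_∈_)
open import Data.List.Membership.Propositional.Properties using (∈-filter⁻; ∈-filter⁺; ∈-map⁺; ∈-upTo⁺)
open import Data.List.Relation.Unary.Any using (here; there)
import Data.List.Relation.Unary.All as All
open All using (All)
import Data.List.Relation.Unary.All.Properties as All
open import Data.List.Relation.Unary.AllPairs using (AllPairs; _∷_)
import Data.List.Relation.Unary.AllPairs.Properties as AllPairs
open import Data.Product using (_,_; proj₁; proj₂)
open import Data.Sum using (_⊎_; inj₁; inj₂)
open import Function using (id; _∘_)
open import Relation.Nullary using (contradiction)
open import Relation.Nullary.Decidable using (Dec; _⊎-dec_; _→-dec_; toWitness)
open import Relation.Binary.PropositionalEquality using (_≡_; refl; sym; trans; cong; cong₂; subst; module ≡-Reasoning)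

nearPerfect⇒≤sum : ∀ {k n} → NearPerfect k n → n ≤ sum (properDivisors n)
nearPerfect⇒≤sum {n = n} (S , _ , _ , sum≡n+S) = subst (n ≤_) (sym sum≡n+S) (m≤m+n n (sum S))

divisors-suc : ∀ m → divisors (suc m) ≡ filter (_∣? suc m) (map suc (upTo m)) ∷ʳ suc m
divisors-suc m = begin
  filter (_∣? n) (map suc (upTo (suc m)))                 ≡⟨ cong (filter (_∣? n) ∘ map suc) (sym (upTo-∷ʳ m)) ⟩
  filter (_∣? n) (map suc (upTo m ++ [ m ]))               ≡⟨ cong (filter (_∣? n)) (map-++ suc (upTo m) [ m ]) ⟩
  filter (_∣? n) (map suc (upTo m) ++ [ n ])               ≡⟨ filter-++ (_∣? n) (map suc (upTo m)) [ n ] ⟩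
  filter (_∣? n) (map suc (upTo m)) ++ filter (_∣? n) [ n ] ≡⟨ cong (filter (_∣? n) (map suc (upTo m)) ++_) (filter-accept (_∣? n) ∣-refl) ⟩
  filter (_∣? n) (map suc (upTo m)) ∷ʳ n                   ∎
  where open ≡-Reasoning; n = suc m

properDivisors-suc : ∀ m → properDivisors (suc m) ≡ filter (_∣? suc m) (map suc (upTo m))
properDivisors-suc m = begin
  filter (_<? n) (divisors n)                  ≡⟨ cong (filter (_<? n)) (divisors-suc m) ⟩
  filter (_<? n) (ds ++ [ n ])                 ≡⟨ filter-++ (_<? n) ds [ n ] ⟩
  filter (_<? n) ds ++ filter (_<? n) [ n ]    ≡⟨ cong₂ _++_ (filter-all (_<? n) ds<n) (filter-reject (_<? n) (n≮n n)) ⟩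
  ds ++ []                                     ≡⟨ ++-identityʳ ds ⟩
  ds                                           ∎
  where
  open ≡-Reasoning
  n = suc m
  ds = filter (_∣? n) (map suc (upTo m))
  ds<n : All (_< n) ds
  ds<n = All.filter⁺ (_∣? n) (All.map⁺ (All.applyUpTo⁺₁ id m s≤s))

τ-suc : ∀ m → τ (suc m) ≡ suc (length (properDivisors (suc m)))
τ-suc m = begin
  length (divisors (suc m))   ≡⟨ cong length (divisors-suc m) ⟩
  length (ds ∷ʳ suc m)        ≡⟨ length-++ ds ⟩
  length ds + 1               ≡⟨ +-comm (length ds) 1 ⟩
  suc (length ds)             ≡⟨ cong (suc ∘ length) (sym (properDivisors-suc m)) ⟩
  suc (length (properDivisors (suc m))) ∎
  where open ≡-Reasoning; ds = filter (_∣? suc m) (map suc (upTo m))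

record IsProperDivisorList (n : ℕ) (xs : List ℕ) : Set where
  field
    ascending : AllPairs _<_ xs
    divisor   : ∀ {x} → x ∈ xs → x ∣ n
    proper    : ∀ {x} → x ∈ xs → x < n
    complete  : ∀ {x} → x ∣ n → x < n → x ∈ xs

open IsProperDivisorList

properDivisors-isProperDivisorList : ∀ m → IsProperDivisorList (suc m) (properDivisors (suc m))
properDivisors-isProperDivisorList m = record
  { ascending = AllPairs.filter⁺ (_<? n) (AllPairs.filter⁺ (_∣? n)
                  (AllPairs.map⁺ (AllPairs.applyUpTo⁺₁ id n (λ i<j _ → s≤s i<j))))
  ; divisor   = λ x∈ → proj₂ (∈-filter⁻ (_∣? n) {xs = map suc (upTo n)} (proj₁ (∈-filter⁻ (_<? n) {xs = divisors n} x∈)))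
  ; proper    = λ x∈ → proj₂ (∈-filter⁻ (_<? n) {xs = divisors n} x∈)
  ; complete  = complete′
  }
  where
  n = suc m
  complete′ : ∀ {x} → x ∣ n → x < n → x ∈ properDivisors n
  complete′ {zero}  0∣n _   = contradiction (0∣⇒≡0 0∣n) λ ()
  complete′ {suc i} x∣n x<n = ∈-filter⁺ (_<? n) (∈-filter⁺ (_∣? n) (∈-map⁺ suc (∈-upTo⁺ (<⇒≤ x<n))) x∣n) x<n

head-≤ : ∀ {a y xs} → AllPairs _<_ (a ∷ xs) → y ∈ a ∷ xs → a ≤ y
head-≤ _          (here refl)  = ≤-refl
head-≤ (a<xs ∷ _) (there y∈xs) = <⇒≤ (All.lookup a<xs y∈xs)

∈-between⇒≡ : ∀ {a b c y xs} → AllPairs _<_ (a ∷ b ∷ c ∷ xs) → y ∈ a ∷ b ∷ c ∷ xs →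
              a < y → y < c → y ≡ b
∈-between⇒≡ _ (here refl)                 a<a _   = contradiction a<a (<-irrefl refl)
∈-between⇒≡ _ (there (here refl))         _   _   = refl
∈-between⇒≡ _ (there (there (here refl))) _   c<c = contradiction c<c (<-irrefl refl)
∈-between⇒≡ (_ ∷ _ ∷ (c<xs ∷ _)) (there (there (there y∈xs))) _ y<c =
  contradiction y<c (<-asym (All.lookup c<xs y∈xs))

head≤1 : ∀ {n a xs} → IsProperDivisorList n (a ∷ xs) → a ≤ 1
head≤1 {a = zero}      _ = z≤n
head≤1 {n} {a = suc _} l =
  head-≤ (ascending l) (complete l (1∣ n) (≤-<-trans (s≤s z≤n) (proper l (here refl))))

≤quotient⇒*≤ : ∀ {k x n} (x∣n : x ∣ n) → k ≤ quotient x∣n → k * x ≤ n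
≤quotient⇒*≤ {x = x} x∣n k≤q = subst (_ ≤_) (sym (_∣_.equality x∣n)) (*-monoˡ-≤ x k≤q)

quotient-anti-< : ∀ {x y n} .{{_ : NonZero n}} (x∣n : x ∣ n) (y∣n : y ∣ n) →
                  x < y → quotient y∣n < quotient x∣n
quotient-anti-< {x} {y} {n} x∣n y∣n x<y = ≰⇒> λ qx≤qy → <-irrefl refl (begin-strict
  n                ≡⟨ _∣_.equality x∣n ⟩
  quotient x∣n * x ≤⟨ *-monoˡ-≤ x qx≤qy ⟩
  quotient y∣n * x <⟨ *-monoʳ-< (quotient y∣n) x<y ⟩
  quotient y∣n * y ≡⟨ sym (_∣_.equality y∣n) ⟩
  n                ∎)
  where open ≤-Reasoning; instance _ = quotient≢0 y∣n

half-bound : ∀ {e n} → e ∣ n → e < n → 2 * e ≤ n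
half-bound e∣n e<n = ≤quotient⇒*≤ e∣n (quotient>1 e∣n e<n)

third-bound : ∀ {d e n} .{{_ : NonZero n}} → d ∣ n → e ∣ n → d < e → e < n → 3 * d ≤ n
third-bound d∣n e∣n d<e e<n =
  ≤quotient⇒*≤ d∣n (≤-<-trans (quotient>1 e∣n e<n) (quotient-anti-< d∣n e∣n d<e))

n≤k+d+e⇒n≤6k : ∀ {n k d e} → 3 * d ≤ n → 2 * e ≤ n → n ≤ k + (d + e) → n ≤ 6 * k
n≤k+d+e⇒n≤6k {n} {k} {d} {e} 3d≤n 2e≤n n≤k+d+e = +-cancelˡ-≤ (5 * n) n (6 * k) (begin
  5 * n + n                          ≡⟨ solve (n ∷ []) ⟩
  6 * n                              ≤⟨ *-monoʳ-≤ 6 n≤k+d+e ⟩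
  6 * (k + (d + e))                  ≡⟨ solve (k ∷ d ∷ e ∷ []) ⟩
  2 * (3 * d) + 3 * (2 * e) + 6 * k  ≤⟨ +-monoˡ-≤ (6 * k) (+-mono-≤ (*-monoʳ-≤ 2 3d≤n) (*-monoʳ-≤ 3 2e≤n)) ⟩
  2 * n + 3 * n + 6 * k              ≡⟨ solve (n ∷ k ∷ []) ⟩
  5 * n + 6 * k                      ∎)
  where open ≤-Reasoning

cancel-third-half : ∀ {n} xs d e → 3 * d ≤ n → 2 * e ≤ n → n ≤ sum (xs ++ d ∷ e ∷ []) → n ≤ 6 * sum xs
cancel-third-half {n} xs d e 3d≤n 2e≤n n≤sum = n≤k+d+e⇒n≤6k {k = sum xs} {d} {e} 3d≤n 2e≤n (subst (n ≤_) sum≡ n≤sum)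
  where
  sum≡ : sum (xs ++ d ∷ e ∷ []) ≡ sum xs + (d + e)
  sum≡ = trans (sum-++ xs (d ∷ e ∷ [])) (cong (λ t → sum xs + (d + t)) (+-identityʳ e))

third-squared-< : ∀ {n a b c d e xs} .{{_ : NonZero n}} →
                  IsProperDivisorList n (a ∷ b ∷ c ∷ d ∷ e ∷ xs) → c * c < n
third-squared-< {n} {a} {b} {c} {d} {e} l@record { ascending = asc@(_ ∷ b<cs ∷ c<ds ∷ d<es ∷ _) } =
  subst (c * c <_) (sym (_∣_.equality c∣n)) (*-monoˡ-< c c<qc)
  where
  b<c : b < c
  b<c = All.head b<cs
  c∣n : c ∣ n
  c∣n = divisor l (there (there (here refl)))
  c<n : c < n
  c<n = proper l (there (there (here refl)))
  d∣n : d ∣ n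
  d∣n = divisor l (there (there (there (here refl))))
  e∣n : e ∣ n
  e∣n = divisor l (there (there (there (there (here refl)))))
  e<n : e < n
  e<n = proper l (there (there (there (there (here refl)))))
  qe<qd : quotient e∣n < quotient d∣n
  qe<qd = quotient-anti-< d∣n e∣n (All.head d<es)
  qd<qc : quotient d∣n < quotient c∣n
  qd<qc = quotient-anti-< c∣n d∣n (All.head c<ds)
  instance
    c≢0 : NonZero c
    c≢0 = >-nonZero (≤-<-trans z≤n b<c)
  only-b : ∀ {y} → y ∣ n → 1 < y → y < c → y ≡ b
  only-b y∣n 1<y y<c = ∈-between⇒≡ asc (complete l y∣n (<-trans y<c c<n)) (≤-<-trans (head≤1 l) 1<y) y<c
  -- otherwise n/e < n/d would be two distinct divisors strictly between 1 and c
  c<qc : c < quotient c∣n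
  c<qc = ≰⇒> λ qc≤c →
    let qd<c : quotient d∣n < c
        qd<c = <-≤-trans qd<qc qc≤c
        1<qe : 1 < quotient e∣n
        1<qe = quotient>1 e∣n e<n
    in <⇒≢ qe<qd (trans (only-b (quotient-∣ e∣n) 1<qe (<-trans qe<qd qd<c))
                        (sym (only-b (quotient-∣ d∣n) (<-trans 1<qe qe<qd) qd<c)))

≤sum-three-proper-divisors⇒≤6 : ∀ {n a b c} .{{_ : NonZero n}} →
  IsProperDivisorList n (a ∷ b ∷ c ∷ []) → n ≤ sum (a ∷ b ∷ c ∷ []) → n ≤ 6
≤sum-three-proper-divisors⇒≤6 {n} {a} {b} {c} l@record { ascending = _ ∷ b<cs ∷ _ } n≤sum = begin
  n           ≤⟨ cancel-third-half (a ∷ []) b c (third-bound b∣n c∣n b<c c<n) (half-bound c∣n c<n) n≤sum ⟩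
  6 * (a + 0) ≤⟨ *-monoʳ-≤ 6 (+-monoˡ-≤ 0 (head≤1 l)) ⟩
  6           ∎
  where
  open ≤-Reasoning
  b<c : b < c
  b<c = All.head b<cs
  b∣n : b ∣ n
  b∣n = divisor l (there (here refl))
  c∣n : c ∣ n
  c∣n = divisor l (there (there (here refl)))
  c<n : c < n
  c<n = proper l (there (there (here refl)))

≤sum-five-proper-divisors⇒≤132 : ∀ {n a b c d e} .{{_ : NonZero n}} →
  IsProperDivisorList n (a ∷ b ∷ c ∷ d ∷ e ∷ []) → n ≤ sum (a ∷ b ∷ c ∷ d ∷ e ∷ []) → n ≤ 132
≤sum-five-proper-divisors⇒≤132 {n} {a} {b} {c} {d} {e} l@record { ascending = _ ∷ b<cs ∷ _ ∷ d<es ∷ _ } n≤sum =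
  ≤-trans n≤12c (*-monoʳ-≤ 12 (≤-pred c<12))
  where
  d∣n : d ∣ n
  d∣n = divisor l (there (there (there (here refl))))
  e∣n : e ∣ n
  e∣n = divisor l (there (there (there (there (here refl)))))
  e<n : e < n
  e<n = proper l (there (there (there (there (here refl)))))
  n≤12c : n ≤ 12 * c
  n≤12c = begin
    n                       ≤⟨ cancel-third-half (a ∷ b ∷ c ∷ []) d e (third-bound d∣n e∣n (All.head d<es) e<n) (half-bound e∣n e<n) n≤sum ⟩
    6 * (a + (b + (c + 0))) ≤⟨ *-monoʳ-≤ 6 (≤-trans (+-monoˡ-≤ _ (head≤1 l)) (+-monoˡ-≤ (c + 0) (All.head b<cs))) ⟩
    6 * (c + (c + 0))       ≡⟨ solve (c ∷ []) ⟩
    12 * c                  ∎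
    where open ≤-Reasoning
  c<12 : c < 12
  c<12 = *-cancelʳ-< c c 12 (<-≤-trans (third-squared-< l) n≤12c)

≤sum-properDivisors⇒≤132 : ∀ m → τ (suc m) ≡ 4 ⊎ τ (suc m) ≡ 6 → suc m ≤ sum (properDivisors (suc m)) → suc m ≤ 132
≤sum-properDivisors⇒≤132 m τ≡ = bound (properDivisors (suc m)) (properDivisors-isProperDivisorList m) (lengths τ≡)
  where
  lengths : τ (suc m) ≡ 4 ⊎ τ (suc m) ≡ 6 →
            length (properDivisors (suc m)) ≡ 3 ⊎ length (properDivisors (suc m)) ≡ 5
  lengths (inj₁ τ≡4) = inj₁ (suc-injective (trans (sym (τ-suc m)) τ≡4))
  lengths (inj₂ τ≡6) = inj₂ (suc-injective (trans (sym (τ-suc m)) τ≡6))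
  bound : ∀ xs → IsProperDivisorList (suc m) xs → length xs ≡ 3 ⊎ length xs ≡ 5 →
          suc m ≤ sum xs → suc m ≤ 132
  bound (_ ∷ _ ∷ _ ∷ [])         l (inj₁ refl) n≤sum = ≤-trans (≤sum-three-proper-divisors⇒≤6 l n≤sum) (m≤m+n 6 126)
  bound (_ ∷ _ ∷ _ ∷ _ ∷ _ ∷ []) l (inj₂ refl) n≤sum = ≤sum-five-proper-divisors⇒≤132 l n≤sum

Listed : ℕ → Set
Listed n = n ≡ 6 ⊎ n ≡ 12 ⊎ n ≡ 18 ⊎ n ≡ 20 ⊎ n ≡ 28

ClaimAt : ℕ → Set
ClaimAt n = τ n ≡ 4 ⊎ τ n ≡ 6 → n ≤ sum (properDivisors n) → Listed n

claimAt? : ∀ n → Dec (ClaimAt n)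
claimAt? n = (τ n ≟ 4 ⊎-dec τ n ≟ 6) →-dec n ≤? sum (properDivisors n) →-dec
             (n ≟ 6 ⊎-dec n ≟ 12 ⊎-dec n ≟ 18 ⊎-dec n ≟ 20 ⊎-dec n ≟ 28)

claimAt-<133 : ∀ {n} → n < 133 → ClaimAt n
claimAt-<133 = toWitness {a? = allUpTo? claimAt? 133} _

lemma3p15 : (m k : ℕ) → NearPerfect k (suc m) → (τ (suc m) ≡ 4 ⊎ τ (suc m) ≡ 6) →
    (suc m ≡ 6) ⊎ (suc m ≡ 12) ⊎ (suc m ≡ 18) ⊎ (suc m ≡ 20) ⊎ (suc m ≡ 28)
lemma3p15 m k near τ≡ = claimAt-<133 (s≤s (≤sum-properDivisors⇒≤132 m τ≡ n≤sum)) τ≡ n≤sum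
  where
  n≤sum : suc m ≤ sum (properDivisors (suc m))
  n≤sum = nearPerfect⇒≤sum near
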